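{- Let $G$ be a $k$-edge-connected $k$-regular graph. Then $k\leq \mathrm{srd}(G)\leq \chi'(G)$.
   Context: $\chi'(G)$ denotes the chromatic index of $G$ (minimum number of colors in a proper edge-coloring). An edge-coloring of $G$ is any map $c:E(G)\to[m]$ (adjacent edges may receive the same color). For distinct vertices $u,v$ of a connected graph $G$, a $u$-$v$-edge-cut is a set $F$ of edges such that $u$ and $v$ lie in different components of $G-F$; a minimum $u$-$v$-edge-cut is one of minimum size among these. A set of edges is rainbow if no two of its edges have the same color. An edge-colored connected graph is strong rainbow disconnected if for every two distinct vertices $u,v$ there is a $u$-$v$-edge-cut that is both rainbow and minimum; $\mathrm{srd}(G)$ is the smallest number of colors of an edge-coloring making $G$ strong rainbow disconnected. -}

module Defs where

open import Data.Nat using (ℕ; zero; suc; _+_; _≤_)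
open import Data.Fin using (Fin; _<_)
open import Data.Fin.Properties using (_<?_)
open import Data.Bool using (Bool; true; false; _∧_; not; if_then_else_)
open import Data.List using (List; map)
open import Data.Nat.ListAction using (sum)
open import Data.Sum using (_⊎_)
open import Data.List using () renaming (allFin to allFinL)
open import Data.Product using (Σ; _×_; _,_; ∃)
open import Relation.Nullary using (¬_; does)
open import Relation.Binary.PropositionalEquality using (_≡_; _≢_)

record Graph (n : ℕ) : Set where
  field
    adj   : Fin n → Fin n → Bool
    sym   : ∀ i j → adj i j ≡ adj j i
    irrefl : ∀ i → adj i i ≡ false
open Graph public

Σv : {n : ℕ} → (Fin n → ℕ) → ℕ
Σv {n} f = sum (map f (allFinL n))

b2n : Bool → ℕ
b2n true  = 1
b2n false = 0

degree : {n : ℕ} → Graph n → Fin n → ℕ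
degree G v = Σv (λ w → b2n (adj G v w))

Regular : {n : ℕ} → ℕ → Graph n → Set
Regular k G = ∀ v → degree G v ≡ k

-- The (unordered) edge {i,j} of G, written canonically with i < j.
IsEdge : {n : ℕ} → Graph n → Fin n → Fin n → Set
IsEdge G i j = (i < j) × (adj G i j ≡ true)

record EdgeSet {n : ℕ} (G : Graph n) : Set where
  field
    mem    : Fin n → Fin n → Bool
    memSym : ∀ i j → mem i j ≡ mem j i
    sub    : ∀ i j → mem i j ≡ true → adj G i j ≡ true
open EdgeSet public

-- number of edges in F (each unordered edge counted once, via i < j)
size : {n : ℕ} {G : Graph n} → EdgeSet G → ℕ
size F = Σv (λ i → Σv (λ j → b2n (does (i <? j) ∧ mem F i j)))

data Reach {n : ℕ} (a : Fin n → Fin n → Bool) (u : Fin n) : Fin n → Set where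
  here : Reach a u u
  step : ∀ {v w} → Reach a u v → a v w ≡ true → Reach a u w

minus : {n : ℕ} (G : Graph n) → EdgeSet G → Fin n → Fin n → Bool
minus G F i j = adj G i j ∧ not (mem F i j)

Connected : {n : ℕ} → Graph n → Set
Connected {n} G = (1 ≤ n) × (∀ u v → Reach (adj G) u v)

EdgeConnected : {n : ℕ} → ℕ → Graph n → Set
EdgeConnected {n} k G =
  Connected G × (∀ (F : EdgeSet G) → suc (size F) ≤ k → ∀ u v → Reach (minus G F) u v)

IsCut : {n : ℕ} (G : Graph n) → EdgeSet G → Fin n → Fin n → Set
IsCut G F u v = ¬ Reach (minus G F) u v

IsMinCut : {n : ℕ} (G : Graph n) → EdgeSet G → Fin n → Fin n → Set
IsMinCut G F u v = IsCut G F u v × (∀ (F' : EdgeSet G) → IsCut G F' u v → size F ≤ size F')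

-- An edge-coloring with colors in Fin m; the color of edge {i,j} (i < j)
-- is c i j (values on other pairs are irrelevant).
Coloring : ℕ → ℕ → Set
Coloring n m = Fin n → Fin n → Fin m

Rainbow : {n m : ℕ} (G : Graph n) → Coloring n m → EdgeSet G → Set
Rainbow G c F = ∀ i j i' j' → i < j → i' < j' →
  mem F i j ≡ true → mem F i' j' ≡ true → c i j ≡ c i' j' → (i ≡ i') × (j ≡ j')

StrongRainbowDisconnected : {n m : ℕ} (G : Graph n) → Coloring n m → Set
StrongRainbowDisconnected G c =
  ∀ u v → u ≢ v → Σ (EdgeSet _) (λ F → IsMinCut G F u v × Rainbow G c F)

Proper : {n m : ℕ} (G : Graph n) → Coloring n m → Set
Proper G c = ∀ i j i' j' → IsEdge G i j → IsEdge G i' j' →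
  (i ≡ i' ⊎ i ≡ j' ⊎ j ≡ i' ⊎ j ≡ j') → c i j ≡ c i' j' → (i ≡ i') × (j ≡ j')

IsSrd : {n : ℕ} → Graph n → ℕ → Set
IsSrd {n} G s = Σ (Coloring n s) (StrongRainbowDisconnected G)
  × (∀ m → Σ (Coloring n m) (StrongRainbowDisconnected G) → s ≤ m)

IsChromaticIndex : {n : ℕ} → Graph n → ℕ → Set
IsChromaticIndex {n} G χ = Σ (Coloring n χ) (Proper G)
  × (∀ m → Σ (Coloring n m) (Proper G) → χ ≤ m)

-- A rainbow u–v cut has pairwise distinct colours, and in a k-edge-connected graph every
-- u–v cut has at least k edges; taking v adjacent to u gives k ≤ srd(G).  Conversely, the
-- k edges at u separate u from every other vertex, so by k-edge-connectivity this star is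
-- a minimum u–v cut, and a proper edge-colouring makes every star rainbow: proper
-- colourings are strong rainbow disconnecting, whence srd(G) ≤ χ'(G).
module Submission where

open import Defs hiding (sym)
open import Data.Nat using (ℕ; zero; suc; _+_; _≤_; z≤n)
open import Data.Nat.Properties using (≤-trans; ≤-reflexive; ≮⇒≥)
open import Data.Fin using (Fin; _<_; fromℕ<)
open import Data.Fin.Properties using (_<?_; _≟_; <-asym; injective⇒≤)
open import Data.Bool using (Bool; true; false; _∧_)
import Data.Bool.Properties as Bool
open import Data.List using (List; []; _∷_; _++_; map; filter; length; lookup; allFin; cartesianProduct)
open import Data.List.Properties using (map-++; map-∘)
open import Data.Nat.ListAction using (sum)
open import Data.Nat.ListAction.Properties using (sum-++)
open import Data.List.Membership.Propositional using (_∈_)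
open import Data.List.Membership.Propositional.Properties using (∈-lookup; ∈-filter⁺; ∈-filter⁻; ∈-allFin)
open import Data.List.Relation.Unary.Any using (index)
open import Data.List.Relation.Unary.Any.Properties using (lookup-index)
open import Data.List.Relation.Unary.All as All using ()
open import Data.List.Relation.Unary.AllPairs using (_∷_)
open import Data.List.Relation.Unary.Unique.Propositional using (Unique)
open import Data.List.Relation.Unary.Unique.Propositional.Properties using (allFin⁺; cartesianProduct⁺; filter⁺)
open import Data.Product using (_×_; _,_; proj₂; ∃; uncurry)
open import Data.Product.Properties using (×-≡,≡→≡)
open import Data.Sum using (_⊎_; inj₁; inj₂)
open import Data.Empty using (⊥-elim)
open import Relation.Nullary using (Dec; yes; does; _⊎-dec_)
open import Relation.Nullary.Decidable using (dec-true)
open import Relation.Binary.PropositionalEquality using (_≡_; _≢_; refl; sym; trans; cong; cong₂; subst)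
open Relation.Binary.PropositionalEquality.≡-Reasoning

does-true⇒ : ∀ {P : Set} (P? : Dec P) → does P? ≡ true → P
does-true⇒ (yes p) _ = p

count : ∀ {A : Set} → (A → Bool) → List A → ℕ
count b xs = sum (map (λ x → b2n (b x)) xs)

count≡length-filter : ∀ {A : Set} (b : A → Bool) (xs : List A) →
  count b xs ≡ length (filter (λ x → b x Bool.≟ true) xs)
count≡length-filter b [] = refl
count≡length-filter b (x ∷ xs) with b x
... | true  = cong suc (count≡length-filter b xs)
... | false = count≡length-filter b xs

count≡suc⇒∃ : ∀ {A : Set} (b : A → Bool) (xs : List A) {m} → count b xs ≡ suc m → ∃ λ x → b x ≡ true
count≡suc⇒∃ b [] ()
count≡suc⇒∃ b (x ∷ xs) e with b x in bx
... | true  = x , bx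
... | false = count≡suc⇒∃ b xs e

Unique⇒lookup-injective : ∀ {A : Set} {xs : List A} → Unique xs → ∀ {i j} → lookup xs i ≡ lookup xs j → i ≡ j
Unique⇒lookup-injective (_ ∷ _) {Fin.zero} {Fin.zero} _ = refl
Unique⇒lookup-injective (x∉xs ∷ _) {Fin.zero} {Fin.suc j} e = ⊥-elim (All.lookup x∉xs (∈-lookup j) e)
Unique⇒lookup-injective (x∉xs ∷ _) {Fin.suc i} {Fin.zero} e = ⊥-elim (All.lookup x∉xs (∈-lookup i) (sym e))
Unique⇒lookup-injective (_ ∷ u) {Fin.suc i} {Fin.suc j} e = cong Fin.suc (Unique⇒lookup-injective u e)

index-injective : ∀ {A : Set} {x y : A} {xs : List A} (p : x ∈ xs) (q : y ∈ xs) → index p ≡ index q → x ≡ y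
index-injective {xs = xs} p q e = trans (lookup-index p) (trans (cong (lookup xs) e) (sym (lookup-index q)))

length≤ : ∀ {A : Set} {xs : List A} {s} → Unique xs → (g : ∀ {x} → x ∈ xs → Fin s) →
  (∀ {x y} (p : x ∈ xs) (q : y ∈ xs) → g p ≡ g q → x ≡ y) → length xs ≤ s
length≤ u g g-inj =
  injective⇒≤ {f = λ i → g (∈-lookup i)} λ e → Unique⇒lookup-injective u (g-inj (∈-lookup _) (∈-lookup _) e)

count≤ : ∀ {A : Set} {b : A → Bool} {xs : List A} {s} → Unique xs → (g : ∀ {x} → b x ≡ true → Fin s) →
  (∀ {x y} (bx : b x ≡ true) (by : b y ≡ true) → g bx ≡ g by → x ≡ y) → count b xs ≤ s
count≤ {b = b} {xs} u g g-inj = subst (_≤ _) (sym (count≡length-filter b xs))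
  (length≤ (filter⁺ P? u) (λ p → g (proj₂ (∈-filter⁻ P? {xs = xs} p))) (λ _ _ → g-inj _ _))
  where
  P? : ∀ x → Dec (b x ≡ true)
  P? x = b x Bool.≟ true

sum-map-sum≡sum-cartesianProduct : ∀ {A B : Set} (xs : List A) (ys : List B) (h : A → B → ℕ) →
  sum (map (λ x → sum (map (h x) ys)) xs) ≡ sum (map (uncurry h) (cartesianProduct xs ys))
sum-map-sum≡sum-cartesianProduct [] ys h = refl
sum-map-sum≡sum-cartesianProduct (x ∷ xs) ys h = begin
  sum (map (h x) ys) + sum (map (λ x → sum (map (h x) ys)) xs)
    ≡⟨ cong₂ _+_ (cong sum (map-∘ ys)) (sum-map-sum≡sum-cartesianProduct xs ys h) ⟩
  sum (map (uncurry h) (map (x ,_) ys)) + sum (map (uncurry h) (cartesianProduct xs ys))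
    ≡⟨ sym (sum-++ (map (uncurry h) (map (x ,_) ys)) _) ⟩
  sum (map (uncurry h) (map (x ,_) ys) ++ map (uncurry h) (cartesianProduct xs ys))
    ≡⟨ cong sum (sym (map-++ (uncurry h) (map (x ,_) ys) _)) ⟩
  sum (map (uncurry h) (cartesianProduct (x ∷ xs) ys)) ∎

module _ {n : ℕ} {G : Graph n} where

  size≤ : ∀ {s} (F : EdgeSet G) (g : ∀ {i j} → i < j → mem F i j ≡ true → Fin s) →
    (∀ i j i' j' (p : i < j) (p' : i' < j') (q : mem F i j ≡ true) (q' : mem F i' j' ≡ true) →
      g p q ≡ g p' q' → i ≡ i' × j ≡ j') →
    size F ≤ s
  size≤ F g g-inj = subst (_≤ _) (sym size≡count)
    (count≤ (cartesianProduct⁺ (allFin⁺ n) (allFin⁺ n)) g′ λ _ _ e → ×-≡,≡→≡ (g-inj _ _ _ _ _ _ _ _ e))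
    where
    inF : Fin n × Fin n → Bool
    inF = uncurry λ i j → does (i <? j) ∧ mem F i j

    size≡count : size F ≡ count inF (cartesianProduct (allFin n) (allFin n))
    size≡count = sum-map-sum≡sum-cartesianProduct (allFin n) (allFin n) λ i j → b2n (does (i <? j) ∧ mem F i j)

    g′ : ∀ {e} → inF e ≡ true → Fin _
    g′ {i , j} e = g (does-true⇒ (i <? j) (Bool.∧-conicalˡ _ _ e)) (Bool.∧-conicalʳ _ _ e)

  rainbow⇒size≤ : ∀ {m} {c : Coloring n m} (F : EdgeSet G) → Rainbow G c F → size F ≤ m
  rainbow⇒size≤ {c = c} F rainbow = size≤ F (λ {i} {j} _ _ → c i j) rainbow

  cut⇒k≤size : ∀ {k u v} → EdgeConnected k G → (F : EdgeSet G) → IsCut G F u v → k ≤ size F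
  cut⇒k≤size {u = u} {v} (_ , survives) F cut = ≮⇒≥ λ lt → cut (survives F lt u v)

  adjacent⇒≢ : ∀ {u v} → adj G u v ≡ true → u ≢ v
  adjacent⇒≢ {u} u~v refl with () ← trans (sym u~v) (irrefl G u)

common-endpoint : ∀ {n} {u i j i' j' : Fin n} → i ≡ u ⊎ j ≡ u → i' ≡ u ⊎ j' ≡ u →
  i ≡ i' ⊎ i ≡ j' ⊎ j ≡ i' ⊎ j ≡ j'
common-endpoint (inj₁ refl) (inj₁ refl) = inj₁ refl
common-endpoint (inj₁ refl) (inj₂ refl) = inj₂ (inj₁ refl)
common-endpoint (inj₂ refl) (inj₁ refl) = inj₂ (inj₂ (inj₁ refl))
common-endpoint (inj₂ refl) (inj₂ refl) = inj₂ (inj₂ (inj₂ refl))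

module Star {n : ℕ} (G : Graph n) (u : Fin n) where

  star : EdgeSet G
  star = record
    { mem    = λ i j → adj G i j ∧ does ((i ≟ u) ⊎-dec (j ≟ u))
    ; memSym = λ i j → cong₂ _∧_ (Graph.sym G i j) (Bool.∨-comm (does (i ≟ u)) (does (j ≟ u)))
    ; sub    = λ i j → Bool.∧-conicalˡ _ _
    }

  star-endpoint : ∀ {i j} → mem star i j ≡ true → i ≡ u ⊎ j ≡ u
  star-endpoint {i} {j} q = does-true⇒ ((i ≟ u) ⊎-dec (j ≟ u)) (Bool.∧-conicalʳ _ _ q)

  minus-star-from-u : ∀ w → minus G star u w ≡ false
  minus-star-from-u w rewrite dec-true (u ≟ u) refl with adj G u w
  ... | true  = refl
  ... | false = refl

  star-isCut : ∀ {v} → u ≢ v → IsCut G star u v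
  star-isCut u≢v r = u≢v (sym (stuck r))
    where
    stuck : ∀ {w} → Reach (minus G star) u w → w ≡ u
    stuck here = refl
    stuck (step r e) with refl ← stuck r with () ← trans (sym e) (minus-star-from-u _)

  opposite : ∀ {i j} → i ≡ u ⊎ j ≡ u → Fin n
  opposite {j = j} (inj₁ _) = j
  opposite {i = i} (inj₂ _) = i

  adj-opposite : ∀ {i j} (e : i ≡ u ⊎ j ≡ u) → adj G i j ≡ true → adj G u (opposite e) ≡ true
  adj-opposite (inj₁ refl) i~j = i~j
  adj-opposite {i} (inj₂ refl) i~j = trans (Graph.sym G u i) i~j

  opposite-injective : ∀ {i j i' j'} → i < j → i' < j' → (e : i ≡ u ⊎ j ≡ u) (e' : i' ≡ u ⊎ j' ≡ u) →
    opposite e ≡ opposite e' → i ≡ i' × j ≡ j'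
  opposite-injective _ _ (inj₁ refl) (inj₁ refl) refl = refl , refl
  opposite-injective _ _ (inj₂ refl) (inj₂ refl) refl = refl , refl
  opposite-injective p p' (inj₁ refl) (inj₂ refl) refl = ⊥-elim (<-asym p p')
  opposite-injective p p' (inj₂ refl) (inj₁ refl) refl = ⊥-elim (<-asym p p')

  star-size≤degree : size star ≤ degree G u
  star-size≤degree = subst (size star ≤_) (sym (count≡length-filter (adj G u) (allFin n)))
    (size≤ star (λ _ q → neighbour-index (adj-opposite (star-endpoint q) (sub star _ _ q)))
      λ _ _ _ _ p p' q q' e → opposite-injective p p' _ _ (index-injective _ _ e))
    where
    neighbour-index : ∀ {w} → adj G u w ≡ true → Fin (length (filter (λ w → adj G u w Bool.≟ true) (allFin n)))
    neighbour-index {w} u~w = index (∈-filter⁺ (λ w → adj G u w Bool.≟ true) (∈-allFin w) u~w)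

  star-isMinCut : ∀ {k v} → EdgeConnected k G → Regular k G → u ≢ v → IsMinCut G star u v
  star-isMinCut ec regular u≢v = star-isCut u≢v ,
    λ F cut → ≤-trans star-size≤degree (≤-trans (≤-reflexive (regular u)) (cut⇒k≤size ec F cut))

  proper⇒star-rainbow : ∀ {m} {c : Coloring n m} → Proper G c → Rainbow G c star
  proper⇒star-rainbow proper i j i' j' p p' q q' =
    proper i j i' j' (p , sub star _ _ q) (p' , sub star _ _ q') (common-endpoint (star-endpoint q) (star-endpoint q'))

proper⇒srd : ∀ {n m k} {G : Graph n} {c : Coloring n m} → EdgeConnected k G → Regular k G →
  Proper G c → StrongRainbowDisconnected G c
proper⇒srd {G = G} ec regular proper u v u≢v =
  star , star-isMinCut ec regular u≢v , proper⇒star-rainbow proper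
  where open Star G u

srd⇒k≤colours : ∀ {n m k} {G : Graph n} {c : Coloring n m} → EdgeConnected k G → Regular k G →
  StrongRainbowDisconnected G c → k ≤ m
srd⇒k≤colours {k = zero} _ _ _ = z≤n
srd⇒k≤colours {n} {k = suc _} {G} ec@((1≤n , _) , _) regular srd =
  let u = fromℕ< 1≤n
      v , u~v = count≡suc⇒∃ (adj G u) (allFin n) (regular u)
      F , (cut , _) , rainbow = srd u v (adjacent⇒≢ {G = G} u~v)
  in ≤-trans (cut⇒k≤size ec F cut) (rainbow⇒size≤ F rainbow)

theorem3p9 : ∀ {n : ℕ} (G : Graph n) (k : ℕ) → EdgeConnected k G → Regular k G →
    ∀ (s χ : ℕ) → IsSrd G s → IsChromaticIndex G χ → (k ≤ s) × (s ≤ χ)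
theorem3p9 G k ec regular s χ ((_ , srd) , s-minimal) ((_ , proper) , _) =
  srd⇒k≤colours {G = G} ec regular srd , s-minimal χ (_ , proper⇒srd {G = G} ec regular proper)
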